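{- Let $G$ be a connected graph of order at least $3$ that is not isomorphic to the cycle $C_5$. Then there exists a partition $(A_1,A_2,A_3)$ of $V(G)$ such that the set $$\mathcal{X} = \bigcup_{i=1}^{3} \bigl( V(G) - N[A_i] \bigr)$$ is an independent set of $G$.
   Context: All graphs are finite and simple. For a set $A$ of vertices, $N[A]$ denotes the closed neighborhood of $A$, i.e., $A$ together with all vertices adjacent to some vertex of $A$. -}

module Defs where

open import Data.Nat using (ℕ; suc; _%_; _≤_)
open import Data.Fin using (Fin; toℕ)
open import Data.Bool using (Bool; T)
open import Data.Empty using (⊥)
open import Data.Product using (Σ; ∃; _×_; _,_)
open import Data.Sum using (_⊎_)
open import Relation.Nullary using (¬_)
open import Relation.Binary.PropositionalEquality using (_≡_)
open import Function.Bundles using (_⤖_; Bijection)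

record Graph : Set where
  field
    n     : ℕ
    adj   : Fin n → Fin n → Bool
    sym   : ∀ u v → T (adj u v) → T (adj v u)
    irrefl : ∀ v → ¬ T (adj v v)

open Graph public

Adj : (G : Graph) → Fin (n G) → Fin (n G) → Set
Adj G u v = T (adj G u v)

data Reach (G : Graph) : Fin (n G) → Fin (n G) → Set where
  here : ∀ {v} → Reach G v v
  step : ∀ {u v w} → Adj G u v → Reach G v w → Reach G u w

Connected : Graph → Set
Connected G = ∀ u v → Reach G u v

Isomorphic : Graph → Graph → Set
Isomorphic G H =
  Σ (Fin (n G) ⤖ Fin (n H)) λ φ →
    ∀ u v → (Adj G u v → Adj H (Bijection.to φ u) (Bijection.to φ v))
          × (Adj H (Bijection.to φ u) (Bijection.to φ v) → Adj G u v)

open import Data.Nat using (_≡ᵇ_)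
open import Data.Bool using (_∨_)

c5adj : Fin 5 → Fin 5 → Bool
c5adj u v = ((suc (toℕ u) % 5) ≡ᵇ toℕ v) ∨ ((suc (toℕ v) % 5) ≡ᵇ toℕ u)

open import Data.Bool.Properties using (∨-comm)
open import Relation.Binary.PropositionalEquality using (subst)
open import Data.Fin using (zero) renaming (suc to fsuc)

c5sym : ∀ u v → T (c5adj u v) → T (c5adj v u)
c5sym u v = subst T (∨-comm (((suc (toℕ u) % 5) ≡ᵇ toℕ v)) ((suc (toℕ v) % 5) ≡ᵇ toℕ u))

c5irrefl : ∀ v → ¬ T (c5adj v v)
c5irrefl zero ()
c5irrefl (fsuc zero) ()
c5irrefl (fsuc (fsuc zero)) ()
c5irrefl (fsuc (fsuc (fsuc zero))) ()
c5irrefl (fsuc (fsuc (fsuc (fsuc zero)))) ()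

C5 : Graph
C5 = record { n = 5 ; adj = c5adj ; sym = c5sym ; irrefl = c5irrefl }

-- A partition of V(G) into three parts A₁,A₂,A₃, given as a part-assignment
-- f : V(G) → Fin 3 (A_i = f⁻¹(i)) with every part nonempty.
IsPartition3 : (G : Graph) → (Fin (n G) → Fin 3) → Set
IsPartition3 G f = ∀ (i : Fin 3) → ∃ λ v → f v ≡ i

InClosedNbhd : (G : Graph) → (Fin (n G) → Fin 3) → Fin 3 → Fin (n G) → Set
InClosedNbhd G f i v = ∃ λ u → f u ≡ i × (u ≡ v ⊎ Adj G u v)

InX : (G : Graph) → (Fin (n G) → Fin 3) → Fin (n G) → Set
InX G f v = ∃ λ (i : Fin 3) → ¬ InClosedNbhd G f i v

Independent : (G : Graph) → (Fin (n G) → Set) → Set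
Independent G S = ∀ u v → S u → S v → ¬ Adj G u v

module Submission where

-- Colour each vertex by a residue mod 3 and let A_i be the i-th colour class. A vertex lies outside
-- 𝒳 iff its closed neighbourhood sees all three colours, so 𝒳 is independent as soon as every edge
-- has such an end. Colouring a depth-first search tree by depth mod 3 achieves this for every edge
-- whose lower end is not the root: in a DFS tree every edge joins a vertex to an ancestor, so the
-- lower end has a parent and a child. To control the root, grow a path p₀ … p_ℓ at p₀ as long as
-- possible and start the search along it; then all neighbours of p₀ are inner vertices of the path,
-- hence have both a parent and a child, unless p₀ ~ p_ℓ. In that case the path closes into a cycle,
-- which is Hamiltonian (otherwise a vertex leaving it gives a longer path). On a Hamiltonian cycle
-- c₀ … c_k the search along c₀ … c_k works if k ≡ 2 (mod 3) or some chord has length ≡ 2 (mod 3);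
-- in the remaining cases an explicit colouring by position along the cycle works, except for C₅.

open import Defs hiding (sym)
open import Data.Bool using (T; T?)
open import Data.Empty using (⊥)
open import Data.Fin using (Fin; toℕ; fromℕ<) renaming (_≟_ to _≟ᶠ_)
open import Data.Fin.Patterns using (0F; 1F; 2F; 3F; 4F)
open import Data.Fin.Properties using (pigeonhole; toℕ<n; toℕ-fromℕ<; toℕ-injective; any?)
  renaming (<⇒≢ to <ᶠ⇒≢)
open import Data.Fin.Subset using (Subset; _∈_; _∉_; _⊂_; ⁅_⁆; _∪_; ∣_∣)
open import Data.Fin.Subset.Properties
  using (_∈?_; x∈⁅x⁆; x∈⁅y⁆⇒x≡y; x∈p∪q⁺; x∈p∪q⁻; p⊂q⇒∣p∣<∣q∣; ∣p∣≤n)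
open import Data.Nat
  using (ℕ; zero; suc; _+_; _*_; _∸_; _≤_; _<_; z≤n; s≤s; s≤s⁻¹; _≤?_; _<?_; _≤ᵇ_; _%_; _/_;
         anyUpTo?)
open import Data.Nat.DivMod using (m≡m%n+[m/n]*n; m%n<n; m<n⇒m%n≡m; %-distribˡ-+; [m+n]%n≡m%n; n%n≡0)
open import Data.Nat.Induction using (<-wellFounded)
open import Data.Nat.Properties
open import Data.Product using (Σ; ∃; _×_; _,_; proj₁; proj₂)
open import Data.Sum as Sum using (_⊎_; inj₁; inj₂; swap)
open import Data.Unit using (⊤)
open import Function using (_∘_)
open import Function.Bundles using (mk⤖)
open import Induction.WellFounded using (Acc; acc)
open import Relation.Binary using (tri<; tri≈; tri>)
open import Relation.Binary.PropositionalEquality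
open import Relation.Nullary using (¬_; Dec; yes; no; contradiction)
open import Relation.Nullary.Decidable using (_×-dec_; ¬?; map′; decidable-stable)

mod3 : ℕ → Fin 3
mod3 0 = 0F
mod3 1 = 1F
mod3 2 = 2F
mod3 (suc (suc (suc i))) = mod3 i

mod3-covers : ∀ m (x : Fin 3) → x ≡ mod3 m ⊎ x ≡ mod3 (1 + m) ⊎ x ≡ mod3 (2 + m)
mod3-covers 0 0F = inj₁ refl
mod3-covers 0 1F = inj₂ (inj₁ refl)
mod3-covers 0 2F = inj₂ (inj₂ refl)
mod3-covers 1 0F = inj₂ (inj₂ refl)
mod3-covers 1 1F = inj₁ refl
mod3-covers 1 2F = inj₂ (inj₁ refl)
mod3-covers 2 0F = inj₂ (inj₁ refl)
mod3-covers 2 1F = inj₂ (inj₂ refl)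
mod3-covers 2 2F = inj₁ refl
mod3-covers (suc (suc (suc m))) x = mod3-covers m x

mod3-∸3 : ∀ {m} → 3 ≤ m → mod3 (m ∸ 3) ≡ mod3 m
mod3-∸3 (s≤s (s≤s (s≤s _))) = refl

mod3≡0⇒∸1 : ∀ {m} → 1 ≤ m → mod3 m ≡ 0F → mod3 (m ∸ 1) ≡ 2F
mod3≡0⇒∸1 {3} _ _ = refl
mod3≡0⇒∸1 {suc (suc (suc (suc m)))} _ e = mod3≡0⇒∸1 {suc m} (s≤s z≤n) e
mod3≡0⇒∸1 {1} _ ()
mod3≡0⇒∸1 {2} _ ()

mod3≡0⇒3≤ : ∀ {m} → 2 ≤ m → mod3 m ≡ 0F → 3 ≤ m
mod3≡0⇒3≤ {2} _ ()
mod3≡0⇒3≤ {suc (suc (suc m))} _ _ = m≤m+n 3 m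

mod3≡1⇒∸2 : ∀ {m} → 2 ≤ m → mod3 m ≡ 1F → mod3 (m ∸ 2) ≡ 2F
mod3≡1⇒∸2 {4} _ _ = refl
mod3≡1⇒∸2 {suc (suc (suc (suc (suc m))))} _ e = mod3≡1⇒∸2 {suc (suc m)} (s≤s (s≤s z≤n)) e
mod3≡1⇒∸2 {1} (s≤s ()) _
mod3≡1⇒∸2 {2} _ ()
mod3≡1⇒∸2 {3} _ ()

mod3≡1⇒7≤ : ∀ {m} → 2 ≤ m → m ≢ 4 → mod3 m ≡ 1F → 7 ≤ m
mod3≡1⇒7≤ {1} (s≤s ()) _ _
mod3≡1⇒7≤ {2} _ _ ()
mod3≡1⇒7≤ {3} _ _ ()
mod3≡1⇒7≤ {4} _ m≢4 _ = contradiction refl m≢4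
mod3≡1⇒7≤ {5} _ _ ()
mod3≡1⇒7≤ {6} _ _ ()
mod3≡1⇒7≤ {suc (suc (suc (suc (suc (suc (suc m))))))} _ _ _ = m≤m+n 7 m

module _ (G : Graph) where

  private
    V : Set
    V = Fin (n G)

  infix 4 _~_ _∈N[_]

  _~_ : V → V → Set
  u ~ v = Adj G u v

  ~-sym : ∀ {u v} → u ~ v → v ~ u
  ~-sym {u} {v} = Graph.sym G u v

  ~-irrefl : ∀ {v} → ¬ v ~ v
  ~-irrefl {v} = Graph.irrefl G v

  ~⇒≢ : ∀ {u v} → u ~ v → u ≢ v
  ~⇒≢ u~u refl = ~-irrefl u~u

  _~?_ : ∀ u v → Dec (u ~ v)
  u ~? v = T? (adj G u v)

  _∈N[_] : V → V → Set
  u ∈N[ v ] = u ≡ v ⊎ u ~ v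

  Dominated : (V → Fin 3) → V → Set
  Dominated f v = ∀ i → InClosedNbhd G f i v

  consecutive⇒dominated : ∀ {f v} m {y₀ y₁ y₂} → y₀ ∈N[ v ] → y₁ ∈N[ v ] → y₂ ∈N[ v ] →
    f y₀ ≡ mod3 m → f y₁ ≡ mod3 (1 + m) → f y₂ ≡ mod3 (2 + m) → Dominated f v
  consecutive⇒dominated m y₀∈ y₁∈ y₂∈ f₀ f₁ f₂ i with mod3-covers m i
  ... | inj₁ i≡         = _ , trans f₀ (sym i≡) , y₀∈
  ... | inj₂ (inj₁ i≡) = _ , trans f₁ (sym i≡) , y₁∈
  ... | inj₂ (inj₂ i≡) = _ , trans f₂ (sym i≡) , y₂∈

  record Admissible (f : V → Fin 3) : Set where
    field
      onto : IsPartition3 G f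
      edge-dominated : ∀ {u v} → u ~ v → Dominated f u ⊎ Dominated f v

  onto-if-residues : ∀ {f x y z} → f x ≡ 0F → f y ≡ 1F → f z ≡ 2F → IsPartition3 G f
  onto-if-residues fx fy fz 0F = _ , fx
  onto-if-residues fx fy fz 1F = _ , fy
  onto-if-residues fx fy fz 2F = _ , fz

  admissible⇒independent : ∀ {f} → Admissible f → Independent G (InX G f)
  admissible⇒independent adm u v (i , u∉) (j , v∉) u~v with Admissible.edge-dominated adm u~v
  ... | inj₁ u-dom = u∉ (u-dom i)
  ... | inj₂ v-dom = v∉ (v-dom j)

  Occurs : (ℕ → V) → ℕ → V → Set
  Occurs f t v = ∃ λ i → i ≤ t × f i ≡ v

  occurs? : ∀ f t v → Dec (Occurs f t v)
  occurs? f t v = map′ (λ (i , i<1+t , e) → i , s≤s⁻¹ i<1+t , e) (λ (i , i≤t , e) → i , s≤s i≤t , e)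
                  (anyUpTo? (λ i → f i ≟ᶠ v) (suc t))

  record Path : Set where
    field
      len : ℕ
      at : ℕ → V  -- only at 0, …, at len matter
      at-adj : ∀ i → i < len → at i ~ at (suc i)
      at-distinct : ∀ {i j} → i < j → j ≤ len → at i ≢ at j

  module _ (P : Path) where
    open Path P

    OnPath : V → Set
    OnPath = Occurs at len

    at-injective : ∀ {i j} → i ≤ len → j ≤ len → at i ≡ at j → i ≡ j
    at-injective {i} {j} i≤ j≤ e with <-cmp i j
    ... | tri< i<j _ _ = contradiction e (at-distinct i<j j≤)
    ... | tri≈ _ i≡j _ = i≡j
    ... | tri> _ _ j<i = contradiction (sym e) (at-distinct j<i i≤)

    path-order-bound : suc len ≤ n G
    path-order-bound with suc len ≤? n G
    ... | yes fits = fits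
    ... | no too-long with pigeonhole (≰⇒> too-long) (λ (i : Fin (suc len)) → at (toℕ i))
    ...   | i , j , i<j , e = contradiction e (at-distinct i<j (s≤s⁻¹ (toℕ<n j)))

    prepend : ∀ {w} → w ~ at 0 → ¬ OnPath w → Path
    prepend {w} w~at0 w∉P = record
      { len = suc len ; at = at′ ; at-adj = at′-adj ; at-distinct = at′-distinct }
      where
      at′ : ℕ → V
      at′ zero = w
      at′ (suc i) = at i
      at′-adj : ∀ i → i < suc len → at′ i ~ at′ (suc i)
      at′-adj zero _ = w~at0
      at′-adj (suc i) i<len = at-adj i (s≤s⁻¹ i<len)
      at′-distinct : ∀ {i j} → i < j → j ≤ suc len → at′ i ≢ at′ j
      at′-distinct {zero} {suc j} _ j≤ e = w∉P (j , s≤s⁻¹ j≤ , sym e)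
      at′-distinct {suc i} {suc j} i<j j≤ = at-distinct (s≤s⁻¹ i<j) (s≤s⁻¹ j≤)

  -- The depth function of a normal spanning tree rooted at r (e.g. a depth-first search tree): every
  -- edge joins a vertex to one of its ancestors, so the lower end of an edge has a child.
  record NormalDepth (r : V) (d : V → ℕ) : Set where
    field
      parent : ∀ {v} → v ≢ r → ∃ λ u → u ~ v × suc (d u) ≡ d v
      adj-distinct : ∀ {u v} → u ~ v → d u ≢ d v
      child : ∀ {u v} → u ~ v → d u < d v → ∃ λ w → u ~ w × d w ≡ suc (d u)

  normal-depth-dominates : ∀ {r d} → NormalDepth r d → ∀ {u v} → u ≢ r → u ~ v → d u < d v →
    Dominated (mod3 ∘ d) u
  normal-depth-dominates {d = d} N u≢r u~v du<dv with NormalDepth.parent N u≢r | NormalDepth.child N u~v du<dv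
  ... | x , x~u , dx | w , u~w , dw =
    consecutive⇒dominated (d x) (inj₂ x~u) (inj₁ refl) (inj₂ (~-sym u~w))
      refl (cong mod3 (sym dx)) (cong mod3 (trans dw (cong suc (sym dx))))

  module DepthFirstSearch (connected : Connected G) (P : Path) where
    open Path P using (len; at; at-adj)

    r : V
    r = at 0

    record State : Set where
      field
        visited : Subset (n G)
        depth : V → ℕ
        top : ℕ
        stack : ℕ → V
        stack-root : stack 0 ≡ r
        stack-visited : ∀ {i} → i ≤ top → stack i ∈ visited
        stack-depth : ∀ {i} → i ≤ top → depth (stack i) ≡ i
        stack-adj : ∀ {i} → i < top → stack i ~ stack (suc i)
        parent : ∀ {v} → v ∈ visited → v ≢ r →
                 ∃ λ u → u ∈ visited × u ~ v × suc (depth u) ≡ depth v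
        closed : ∀ {v w} → v ∈ visited → ¬ Occurs stack top v → v ~ w → w ∈ visited
        adj-distinct : ∀ {u v} → u ∈ visited → v ∈ visited → u ~ v → depth u ≢ depth v
        child : ∀ {u v} → u ∈ visited → v ∈ visited → u ~ v → depth u < depth v →
                ∃ λ w → w ∈ visited × u ~ w × depth w ≡ suc (depth u)

      Saturated : Set
      Saturated = ∀ {w} → stack top ~ w → w ∈ visited

      closed-below : Saturated → ∀ {v w} → v ∈ visited → (∀ {i} → i < top → stack i ≢ v) → v ~ w →
                     w ∈ visited
      closed-below saturated {v} v∈ below v~w with stack top ≟ᶠ v
      ... | yes refl = saturated v~w
      ... | no top≢v = closed v∈ off v~w
        where
        off : ¬ Occurs stack top v
        off (i , i≤top , e) with m≤n⇒m<n∨m≡n i≤top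
        ... | inj₁ i<top = below i<top e
        ... | inj₂ refl = top≢v e

    open State

    module Start where
      vertices : ℕ → Subset (n G)
      vertices zero = ⁅ at 0 ⁆
      vertices (suc i) = ⁅ at (suc i) ⁆ ∪ vertices i

      at∈vertices : ∀ {i j} → j ≤ i → at j ∈ vertices i
      at∈vertices {zero} z≤n = x∈⁅x⁆ (at 0)
      at∈vertices {suc i} j≤1+i with m≤n⇒m<n∨m≡n j≤1+i
      ... | inj₁ j<1+i = x∈p∪q⁺ (inj₂ (at∈vertices (s≤s⁻¹ j<1+i)))
      ... | inj₂ refl = x∈p∪q⁺ (inj₁ (x∈⁅x⁆ (at (suc i))))

      vertices⇒occurs : ∀ {i v} → v ∈ vertices i → Occurs at i v
      vertices⇒occurs {zero} v∈ = 0 , z≤n , sym (x∈⁅y⁆⇒x≡y _ v∈)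
      vertices⇒occurs {suc i} v∈ with x∈p∪q⁻ ⁅ at (suc i) ⁆ (vertices i) v∈
      ... | inj₁ v∈⁅⁆ = suc i , ≤-refl , sym (x∈⁅y⁆⇒x≡y _ v∈⁅⁆)
      ... | inj₂ v∈vs with vertices⇒occurs v∈vs
      ...   | j , j≤i , e = j , m≤n⇒m≤1+n j≤i , e

      index : V → ℕ
      index v with occurs? at len v
      ... | yes (i , _) = i
      ... | no _ = 0

      index-at : ∀ {i} → i ≤ len → index (at i) ≡ i
      index-at {i} i≤ with occurs? at len (at i)
      ... | yes (j , j≤ , e) = at-injective P j≤ i≤ e
      ... | no off = contradiction (i , i≤ , refl) off

      data PathVertex : V → Set where
        on : ∀ {i} → i ≤ len → PathVertex (at i)

      view : ∀ {v} → v ∈ vertices len → PathVertex v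
      view v∈ with vertices⇒occurs v∈
      ... | i , i≤ , refl = on i≤

      path-parent : ∀ {v} → v ∈ vertices len → v ≢ r →
                    ∃ λ u → u ∈ vertices len × u ~ v × suc (index u) ≡ index v
      path-parent v∈ v≢r with view v∈
      ... | on {zero} _ = contradiction refl v≢r
      ... | on {suc i} i<len = at i , at∈vertices (<⇒≤ i<len) , at-adj i i<len ,
                               trans (cong suc (index-at (<⇒≤ i<len))) (sym (index-at i<len))

      path-adj-distinct : ∀ {u v} → u ∈ vertices len → v ∈ vertices len → u ~ v → index u ≢ index v
      path-adj-distinct u∈ v∈ u~v with view u∈ | view v∈
      ... | on i≤ | on j≤ = λ e → ~⇒≢ u~v (cong at (trans (sym (index-at i≤)) (trans e (index-at j≤))))

      path-child : ∀ {u v} → u ∈ vertices len → v ∈ vertices len → u ~ v → index u < index v →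
               ∃ λ w → w ∈ vertices len × u ~ w × index w ≡ suc (index u)
      path-child u∈ v∈ u~v iu<iv with view u∈ | view v∈
      ... | on {i} i≤ | on {j} j≤ = at (suc i) , at∈vertices i<len , at-adj i i<len ,
                                     trans (index-at i<len) (cong suc (sym (index-at i≤)))
        where
        i<len : i < len
        i<len = <-≤-trans (subst₂ _<_ (index-at i≤) (index-at j≤) iu<iv) j≤

      state : State
      state = record
        { visited = vertices len ; depth = index ; top = len ; stack = at ; stack-root = refl
        ; stack-visited = at∈vertices ; stack-depth = index-at ; stack-adj = at-adj _
        ; parent = path-parent ; closed = λ v∈ off _ → contradiction (vertices⇒occurs v∈) off
        ; adj-distinct = path-adj-distinct ; child = path-child }

    module Push (s : State) {w : V} (w∉ : w ∉ visited s) (top~w : stack s (top s) ~ w) where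
      private
        module s = State s

      visited′ : Subset (n G)
      visited′ = ⁅ w ⁆ ∪ s.visited

      old∈ : ∀ {v} → v ∈ s.visited → v ∈ visited′
      old∈ v∈ = x∈p∪q⁺ (inj₂ v∈)

      new∈ : w ∈ visited′
      new∈ = x∈p∪q⁺ (inj₁ (x∈⁅x⁆ w))

      data Visited′ : V → Set where
        old : ∀ {v} → v ∈ s.visited → Visited′ v
        new : Visited′ w

      view : ∀ {v} → v ∈ visited′ → Visited′ v
      view v∈ with x∈p∪q⁻ ⁅ w ⁆ s.visited v∈
      ... | inj₁ v∈⁅w⁆ rewrite x∈⁅y⁆⇒x≡y w v∈⁅w⁆ = new
      ... | inj₂ v∈old = old v∈old

      depth′ : V → ℕ
      depth′ v with v ∈? s.visited
      ... | yes _ = s.depth v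
      ... | no _ = suc s.top

      depth′-old : ∀ {v} → v ∈ s.visited → depth′ v ≡ s.depth v
      depth′-old {v} v∈ with v ∈? s.visited
      ... | yes _ = refl
      ... | no v∉ = contradiction v∈ v∉

      depth′-new : depth′ w ≡ suc s.top
      depth′-new with w ∈? s.visited
      ... | yes w∈ = contradiction w∈ w∉
      ... | no _ = refl

      stack′ : ℕ → V
      stack′ i with i ≤? s.top
      ... | yes _ = s.stack i
      ... | no _ = w

      stack′-old : ∀ {i} → i ≤ s.top → stack′ i ≡ s.stack i
      stack′-old {i} i≤ with i ≤? s.top
      ... | yes _ = refl
      ... | no i≰ = contradiction i≤ i≰

      stack′-new : stack′ (suc s.top) ≡ w
      stack′-new with suc s.top ≤? s.top
      ... | yes 1+top≤top = contradiction 1+top≤top (1+n≰n)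
      ... | no _ = refl

      data Slot (i : ℕ) : Set where
        below : i ≤ s.top → Slot i
        at-top : i ≡ suc s.top → Slot i

      slot : ∀ {i} → i ≤ suc s.top → Slot i
      slot i≤ with m≤n⇒m<n∨m≡n i≤
      ... | inj₁ i<1+top = below (s≤s⁻¹ i<1+top)
      ... | inj₂ i≡ = at-top i≡

      neighbour-on-stack : ∀ {u} → u ∈ s.visited → u ~ w → Occurs s.stack s.top u
      neighbour-on-stack {u} u∈ u~w with occurs? s.stack s.top u
      ... | yes on = on
      ... | no off = contradiction (s.closed u∈ off u~w) w∉

      old-below-new : ∀ {u} → u ∈ s.visited → u ~ w → depth′ u < depth′ w
      old-below-new u∈ u~w with neighbour-on-stack u∈ u~w
      ... | i , i≤top , refl =
        subst₂ _<_ (sym (trans (depth′-old u∈) (s.stack-depth i≤top))) (sym depth′-new) (s≤s i≤top)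

      old-new-child : ∀ {u} → u ∈ s.visited → u ~ w →
                      ∃ λ z → z ∈ visited′ × u ~ z × depth′ z ≡ suc (depth′ u)
      old-new-child u∈ u~w with neighbour-on-stack u∈ u~w
      ... | i , i≤top , refl = next (m≤n⇒m<n∨m≡n i≤top)
        where
        du≡i : depth′ (s.stack i) ≡ i
        du≡i = trans (depth′-old u∈) (s.stack-depth i≤top)
        next : i < s.top ⊎ i ≡ s.top →
               ∃ λ z → z ∈ visited′ × s.stack i ~ z × depth′ z ≡ suc (depth′ (s.stack i))
        next (inj₁ i<top) = s.stack (suc i) , old∈ (s.stack-visited i<top) , s.stack-adj i<top ,
                            trans (depth′-old (s.stack-visited i<top))
                              (trans (s.stack-depth i<top) (cong suc (sym du≡i)))
        next (inj₂ refl) = w , new∈ , u~w , trans depth′-new (cong suc (sym du≡i))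

      stack-visited′ : ∀ {i} → i ≤ suc s.top → stack′ i ∈ visited′
      stack-visited′ i≤ with slot i≤
      ... | below i≤top = subst (_∈ visited′) (sym (stack′-old i≤top)) (old∈ (s.stack-visited i≤top))
      ... | at-top refl = subst (_∈ visited′) (sym stack′-new) new∈

      stack-depth′ : ∀ {i} → i ≤ suc s.top → depth′ (stack′ i) ≡ i
      stack-depth′ i≤ with slot i≤
      ... | below i≤top = trans (cong depth′ (stack′-old i≤top))
                            (trans (depth′-old (s.stack-visited i≤top)) (s.stack-depth i≤top))
      ... | at-top refl = trans (cong depth′ stack′-new) depth′-new

      stack-adj′ : ∀ {i} → i < suc s.top → stack′ i ~ stack′ (suc i)
      stack-adj′ {i} i<1+top with m≤n⇒m<n∨m≡n (s≤s⁻¹ i<1+top)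
      ... | inj₁ i<top =
        subst₂ _~_ (sym (stack′-old (<⇒≤ i<top))) (sym (stack′-old i<top)) (s.stack-adj i<top)
      ... | inj₂ refl = subst₂ _~_ (sym (stack′-old ≤-refl)) (sym stack′-new) top~w

      parent′ : ∀ {v} → v ∈ visited′ → v ≢ r →
                ∃ λ u → u ∈ visited′ × u ~ v × suc (depth′ u) ≡ depth′ v
      parent′ v∈ v≢r with view v∈
      ... | new = s.stack s.top , old∈ top∈ , top~w ,
                  trans (cong suc (trans (depth′-old top∈) (s.stack-depth ≤-refl))) (sym depth′-new)
        where top∈ = s.stack-visited ≤-refl
      ... | old v∈old with s.parent v∈old v≢r
      ...   | u , u∈ , u~v , du = u , old∈ u∈ , u~v ,
                                  trans (cong suc (depth′-old u∈)) (trans du (sym (depth′-old v∈old)))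

      closed′ : ∀ {v z} → v ∈ visited′ → ¬ Occurs stack′ (suc s.top) v → v ~ z → z ∈ visited′
      closed′ v∈ off v~z with view v∈
      ... | new = contradiction (suc s.top , ≤-refl , stack′-new) off
      ... | old v∈old = old∈ (s.closed v∈old off-old v~z)
        where
        off-old : ¬ Occurs s.stack s.top _
        off-old (i , i≤top , e) = off (i , m≤n⇒m≤1+n i≤top , trans (stack′-old i≤top) e)

      adj-distinct′ : ∀ {u v} → u ∈ visited′ → v ∈ visited′ → u ~ v → depth′ u ≢ depth′ v
      adj-distinct′ u∈ v∈ u~v with view u∈ | view v∈
      ... | new | new = contradiction u~v ~-irrefl
      ... | old u∈old | new = <⇒≢ (old-below-new u∈old u~v)
      ... | new | old v∈old = ≢-sym (<⇒≢ (old-below-new v∈old (~-sym u~v)))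
      ... | old u∈old | old v∈old = λ e →
        s.adj-distinct u∈old v∈old u~v (trans (sym (depth′-old u∈old)) (trans e (depth′-old v∈old)))

      child′ : ∀ {u v} → u ∈ visited′ → v ∈ visited′ → u ~ v → depth′ u < depth′ v →
               ∃ λ z → z ∈ visited′ × u ~ z × depth′ z ≡ suc (depth′ u)
      child′ u∈ v∈ u~v du<dv with view u∈ | view v∈
      ... | new | new = contradiction u~v ~-irrefl
      ... | old u∈old | new = old-new-child u∈old u~v
      ... | new | old v∈old = contradiction du<dv (<⇒≯ (old-below-new v∈old (~-sym u~v)))
      ... | old u∈old | old v∈old
        with s.child u∈old v∈old u~v (subst₂ _<_ (depth′-old u∈old) (depth′-old v∈old) du<dv)
      ...   | z , z∈ , u~z , dz = z , old∈ z∈ , u~z ,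
                                  trans (depth′-old z∈) (trans dz (cong suc (sym (depth′-old u∈old))))

      state : State
      state = record
        { visited = visited′ ; depth = depth′ ; top = suc s.top ; stack = stack′
        ; stack-root = trans (stack′-old z≤n) s.stack-root
        ; stack-visited = stack-visited′ ; stack-depth = stack-depth′ ; stack-adj = stack-adj′
        ; parent = parent′ ; closed = closed′ ; adj-distinct = adj-distinct′ ; child = child′ }

      grows : s.visited ⊂ visited′
      grows = old∈ , w , new∈ , w∉

    pop : (s : State) → Saturated s → ∀ {t} → top s ≡ suc t → State
    pop s saturated {t} top≡ = record
      { visited = s.visited ; depth = s.depth ; top = t ; stack = s.stack ; stack-root = s.stack-root
      ; stack-visited = s.stack-visited ∘ lower ; stack-depth = s.stack-depth ∘ lower
      ; stack-adj = s.stack-adj ∘ lower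
      ; parent = s.parent
      ; closed = λ v∈ off →
          closed-below s saturated v∈ λ i<top e → off (_ , s≤s⁻¹ (subst (_ <_) top≡ i<top) , e)
      ; adj-distinct = s.adj-distinct ; child = s.child }
      where
      module s = State s
      lower : ∀ {i} → i ≤ t → i ≤ s.top
      lower i≤t = subst (_ ≤_) (sym top≡) (m≤n⇒m≤1+n i≤t)

    finish : (s : State) → Saturated s → top s ≡ 0 → NormalDepth r (depth s)
    finish s saturated top≡0 = record
      { parent = λ v≢r → let (u , _ , u~v , du) = s.parent (all-visited _) v≢r in u , u~v , du
      ; adj-distinct = s.adj-distinct (all-visited _) (all-visited _)
      ; child = λ u~v du<dv →
          let (w , _ , u~w , dw) = s.child (all-visited _) (all-visited _) u~v du<dv in w , u~w , dw }
      where
      module s = State s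
      reach-visited : ∀ {u v} → Reach G u v → u ∈ s.visited → v ∈ s.visited
      reach-visited here u∈ = u∈
      reach-visited (step u~x x⇝v) u∈ =
        reach-visited x⇝v
          (closed-below s saturated u∈ (λ i<top → contradiction (subst (_ <_) top≡0 i<top) λ ()) u~x)
      all-visited : ∀ v → v ∈ s.visited
      all-visited v = reach-visited (connected r v) (subst (_∈ s.visited) s.stack-root (s.stack-visited z≤n))

    measure : State → ℕ
    measure s = 2 * (n G ∸ ∣ visited s ∣) + top s

    push-decreases : ∀ s {w} (w∉ : w ∉ visited s) (top~w : stack s (top s) ~ w) →
      measure (Push.state s w∉ top~w) < measure s
    push-decreases s w∉ top~w = begin-strict
      2 * a′ + suc (top s)   ≡⟨ +-suc (2 * a′) (top s) ⟩
      suc (2 * a′ + top s)   <⟨ n<1+n _ ⟩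
      2 + 2 * a′ + top s     ≡⟨ cong (_+ top s) (sym (*-suc 2 a′)) ⟩
      2 * suc a′ + top s     ≤⟨ +-monoˡ-≤ (top s) (*-monoʳ-≤ 2 a′<a) ⟩
      2 * a + top s          ∎
      where
      open ≤-Reasoning
      a = n G ∸ ∣ visited s ∣
      a′ = n G ∸ ∣ Push.visited′ s w∉ top~w ∣
      a′<a : a′ < a
      a′<a = ∸-monoʳ-< (p⊂q⇒∣p∣<∣q∣ (Push.grows s w∉ top~w))
                        (∣p∣≤n (Push.visited′ s w∉ top~w))

    pop-decreases : ∀ s (saturated : Saturated s) {t} (top≡ : top s ≡ suc t) →
      measure (pop s saturated top≡) < measure s
    pop-decreases s _ {t} top≡ =
      subst (λ x → 2 * a + t < 2 * a + x) (sym top≡) (+-monoʳ-< (2 * a) (n<1+n t))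
      where a = n G ∸ ∣ visited s ∣

    Extension : State → Set
    Extension s = Σ (V → ℕ) λ d → NormalDepth r d × (∀ {v} → v ∈ visited s → d v ≡ depth s v)

    run : (s : State) → Acc _<_ (measure s) → Extension s
    run s (acc more) with any? (λ w → (stack s (top s) ~? w) ×-dec ¬? (w ∈? visited s))
    ... | yes (w , top~w , w∉) with run (Push.state s w∉ top~w) (more (push-decreases s w∉ top~w))
    ...   | d , normal , agrees =
      d , normal , λ v∈ → trans (agrees (Push.old∈ s w∉ top~w v∈)) (Push.depth′-old s w∉ top~w v∈)
    run s (acc more) | no no-unvisited-neighbour = finish-or-pop (top s) refl
      where
      saturated : Saturated s
      saturated {w} top~w with w ∈? visited s
      ... | yes w∈ = w∈
      ... | no w∉ = contradiction (w , top~w , w∉) no-unvisited-neighbour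

      finish-or-pop : ∀ t → top s ≡ t → Extension s
      finish-or-pop zero top≡0 = depth s , finish s saturated top≡0 , λ _ → refl
      finish-or-pop (suc t) top≡ =
        run (pop s saturated top≡) (more (pop-decreases s saturated top≡))

    normal-depth-along : ∃ λ d → NormalDepth r d × (∀ {j} → j ≤ len → d (at j) ≡ j)
    normal-depth-along with run Start.state (<-wellFounded (measure Start.state))
    ... | d , normal , agrees =
      d , normal , λ j≤ → trans (agrees (stack-visited Start.state j≤)) (stack-depth Start.state j≤)

  open DepthFirstSearch using (normal-depth-along)

  module _ (P : Path) where
    open Path P

    RootNeighboursInner : Set
    RootNeighboursInner = ∀ {w} → at 0 ~ w → ∃ λ i → i < len × at i ≡ w

    RootSeesResidue2 : Set
    RootSeesResidue2 = ∃ λ j → j ≤ len × mod3 j ≡ 2F × at 0 ~ at j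

    inner-dominated : ∀ {d} → (∀ {j} → j ≤ len → d (at j) ≡ j) → ∀ {i} → suc i < len →
      Dominated (mod3 ∘ d) (at (suc i))
    inner-dominated d-at {i} 1+i<len =
      consecutive⇒dominated i
        (inj₂ (at-adj i (<⇒≤ 1+i<len))) (inj₁ refl) (inj₂ (~-sym (at-adj (suc i) 1+i<len)))
        (cong mod3 (d-at (≤-trans (n≤1+n i) (<⇒≤ 1+i<len))))
        (cong mod3 (d-at (<⇒≤ 1+i<len)))
        (cong mod3 (d-at 1+i<len))

    path-admissible : Connected G → 2 ≤ len → RootSeesResidue2 ⊎ RootNeighboursInner → ∃ Admissible
    path-admissible connected 2≤len root-ok with normal-depth-along connected P
    ... | d , normal , d-at =
      mod3 ∘ d , record { onto = onto-if-residues (colour 0 z≤n) (colour 1 1≤len) (colour 2 2≤len)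
                        ; edge-dominated = edge-dominated }
      where
      1≤len = ≤-trans (n≤1+n 1) 2≤len

      colour : ∀ j → j ≤ len → mod3 (d (at j)) ≡ mod3 j
      colour j j≤ = cong mod3 (d-at j≤)

      root-edge : ∀ {v} → at 0 ~ v → RootSeesResidue2 ⊎ RootNeighboursInner →
                  Dominated (mod3 ∘ d) (at 0) ⊎ Dominated (mod3 ∘ d) v
      root-edge _ (inj₁ (j , j≤ , j≡2 , at0~atj)) = inj₁
        (consecutive⇒dominated 0 (inj₁ refl) (inj₂ (~-sym (at-adj 0 1≤len))) (inj₂ (~-sym at0~atj))
          (colour 0 z≤n) (colour 1 1≤len) (trans (colour j j≤) j≡2))
      root-edge at0~v (inj₂ inner) with inner at0~v
      ... | zero , _ , refl = contradiction at0~v ~-irrefl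
      ... | suc i , 1+i<len , refl = inj₂ (inner-dominated {d} d-at 1+i<len)

      lower-end : ∀ {u v} → u ~ v → d u < d v → Dominated (mod3 ∘ d) u ⊎ Dominated (mod3 ∘ d) v
      lower-end {u} u~v du<dv with u ≟ᶠ at 0
      ... | yes refl = root-edge u~v root-ok
      ... | no u≢r = inj₁ (normal-depth-dominates normal u≢r u~v du<dv)

      edge-dominated : ∀ {u v} → u ~ v → Dominated (mod3 ∘ d) u ⊎ Dominated (mod3 ∘ d) v
      edge-dominated {u} {v} u~v with <-cmp (d u) (d v)
      ... | tri< du<dv _ _ = lower-end u~v du<dv
      ... | tri≈ _ du≡dv _ = contradiction du≡dv (NormalDepth.adj-distinct normal u~v)
      ... | tri> _ _ dv<du = swap (lower-end (~-sym u~v) dv<du)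

  record Cycle : Set where
    field
      k : ℕ
      c : ℕ → V
      periodic : ∀ i → c (i + suc k) ≡ c i
      adjacent : ∀ i → c i ~ c (suc i)
      distinct : ∀ a {j} → 0 < j → j ≤ k → c a ≢ c (a + j)

  module _ (C : Cycle) where
    open Cycle C

    unroll : Path
    unroll = record
      { len = k ; at = c ; at-adj = λ i _ → adjacent i
      ; at-distinct = λ {i} {j} i<j j≤k e →
          distinct i (m<n⇒0<n∸m i<j) (≤-trans (m∸n≤m j i) j≤k)
            (trans e (cong c (sym (m+[n∸m]≡n (<⇒≤ i<j))))) }

    rotate : ℕ → Cycle
    rotate s = record
      { k = k ; c = λ i → c (s + i)
      ; periodic = λ i → trans (cong c (sym (+-assoc s i (suc k)))) (periodic (s + i))
      ; adjacent = λ i → subst (c (s + i) ~_) (cong c (sym (+-suc s i))) (adjacent (s + i))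
      ; distinct = λ a 0<j j≤k e → distinct (s + a) 0<j j≤k (trans e (cong c (sym (+-assoc s a _)))) }

    wrap : c k ~ c 0
    wrap = subst (c k ~_) (periodic 0) (adjacent k)

    periodic* : ∀ m i → c (m * suc k + i) ≡ c i
    periodic* zero i = refl
    periodic* (suc m) i = begin
      c (suc k + m * suc k + i)   ≡⟨ cong c (+-assoc (suc k) (m * suc k) i) ⟩
      c (suc k + (m * suc k + i)) ≡⟨ cong c (+-comm (suc k) _) ⟩
      c (m * suc k + i + suc k)   ≡⟨ periodic _ ⟩
      c (m * suc k + i)           ≡⟨ periodic* m i ⟩
      c i                         ∎
      where open ≡-Reasoning

    Hamiltonian : Set
    Hamiltonian = ∀ v → ∃ λ i → c i ≡ v

    hamiltonian-index : Hamiltonian → ∀ v → ∃ λ i → i ≤ k × c i ≡ v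
    hamiltonian-index ham v with ham v
    ... | i , refl = i % suc k , s≤s⁻¹ (m%n<n i (suc k)) , sym (begin
      c i                             ≡⟨ cong c (m≡m%n+[m/n]*n i (suc k)) ⟩
      c (i % suc k + i / suc k * suc k) ≡⟨ cong c (+-comm (i % suc k) _) ⟩
      c (i / suc k * suc k + i % suc k) ≡⟨ periodic* (i / suc k) (i % suc k) ⟩
      c (i % suc k)                   ∎)
      where open ≡-Reasoning

  path-from : Cycle → ℕ → Path
  path-from C s = unroll (rotate C s)

  rotate-hamiltonian : ∀ C s → Hamiltonian C → Hamiltonian (rotate C s)
  rotate-hamiltonian C s ham v with ham v
  ... | i , refl = s * k + i , (begin
    c (s + (s * k + i))  ≡⟨ cong c (sym (+-assoc s (s * k) i)) ⟩
    c (s + s * k + i)    ≡⟨ cong (λ x → c (x + i)) (sym (*-suc s k)) ⟩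
    c (s * suc k + i)    ≡⟨ periodic* C s i ⟩
    c i                  ∎)
    where open Cycle C
          open ≡-Reasoning

  module _ (P : Path) (1≤len : 1 ≤ Path.len P) (closing : Path.at P 0 ~ Path.at P (Path.len P)) where
    open Path P

    private
      N : ℕ
      N = suc len

      %-shift : ∀ a {j} → j < N → (a + j) % N ≡ (a % N + j) % N
      %-shift a {j} j<N = trans (%-distribˡ-+ a j N) (cong (λ x → (a % N + x) % N) (m<n⇒m%n≡m j<N))

      wrapped : ∀ {x} → N ≤ x → x ∸ N < N → x % N ≡ x ∸ N
      wrapped {x} N≤x x∸N<N = begin
        x % N             ≡⟨ cong (_% N) (sym (m∸n+n≡m N≤x)) ⟩
        (x ∸ N + N) % N   ≡⟨ [m+n]%n≡m%n (x ∸ N) N ⟩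
        (x ∸ N) % N       ≡⟨ m<n⇒m%n≡m x∸N<N ⟩
        x ∸ N             ∎
        where open ≡-Reasoning

      suc-% : ∀ i → suc i % N ≡ suc (i % N) % N
      suc-% i = trans (%-distribˡ-+ 1 i N) (cong (λ x → (x + i % N) % N) (m<n⇒m%n≡m (s≤s 1≤len)))

      adjacent′ : ∀ i → at (i % N) ~ at (suc i % N)
      adjacent′ i with m≤n⇒m<n∨m≡n (m%n<n i N)
      ... | inj₁ 1+r<N = subst (λ x → at (i % N) ~ at x) (sym (trans (suc-% i) (m<n⇒m%n≡m 1+r<N)))
                               (at-adj (i % N) (s≤s⁻¹ 1+r<N))
      ... | inj₂ 1+r≡N = subst₂ (λ x y → at x ~ at y) (sym (suc-injective 1+r≡N))
                                (sym (trans (suc-% i) (trans (cong (_% N) 1+r≡N) (n%n≡0 N))))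
                                (~-sym closing)

      distinct′ : ∀ a {j} → 0 < j → j ≤ len → at (a % N) ≢ at ((a + j) % N)
      distinct′ a {j} 0<j j≤len e = moved (trans same (%-shift a (s≤s j≤len)))
        where
        r = a % N
        r<N = m%n<n a N
        same : r ≡ (a + j) % N
        same = at-injective P (s≤s⁻¹ r<N) (s≤s⁻¹ (m%n<n (a + j) N)) e
        moved : r ≢ (r + j) % N
        moved with r + j <? N
        ... | yes r+j<N = λ e′ → <⇒≢ (m<m+n r 0<j) (trans e′ (m<n⇒m%n≡m r+j<N))
        ... | no r+j≮N = λ e′ → <⇒≢ r+j∸N<r (sym (trans e′ (wrapped N≤r+j (<-trans r+j∸N<r r<N))))
          where
          N≤r+j = ≮⇒≥ r+j≮N
          r+j∸N<r : r + j ∸ N < r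
          r+j∸N<r = subst (r + j ∸ N <_) (m+n∸n≡m r N) (∸-monoˡ-< (+-monoʳ-< r (s≤s j≤len)) N≤r+j)

    close : Cycle
    close = record
      { k = len ; c = λ i → at (i % suc len)
      ; periodic = λ i → cong at ([m+n]%n≡m%n i (suc len))
      ; adjacent = adjacent′ ; distinct = distinct′ }

    close-at : ∀ {i} → i ≤ len → Cycle.c close i ≡ at i
    close-at i≤len = cong at (m<n⇒m%n≡m (s≤s i≤len))

    close-on-path : ∀ i → OnPath P (Cycle.c close i)
    close-on-path i = i % suc len , s≤s⁻¹ (m%n<n i (suc len)) , refl

  crossing : (S : V → Set) → (∀ v → Dec (S v)) → ∀ {x y} → Reach G x y → S x → ¬ S y →
             ∃ λ u → ∃ λ w → S u × ¬ S w × u ~ w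
  crossing S S? here Sx ¬Sy = contradiction Sx ¬Sy
  crossing S S? (step {v = z} x~z z⇝y) Sx ¬Sy with S? z
  ... | yes Sz = crossing S S? z⇝y Sz ¬Sy
  ... | no ¬Sz = _ , z , Sx , ¬Sz , x~z

  spanning-order-bound : (P : Path) → (∀ v → OnPath P v) → n G ≤ suc (Path.len P)
  spanning-order-bound P spans with n G ≤? suc len
    where open Path P
  ... | yes fits = fits
  ... | no too-many with pigeonhole (≰⇒> too-many) (λ v → fromℕ< (s≤s (proj₁ (proj₂ (spans v)))))
  ...   | u , v , u<v , e = contradiction (trans (sym (located u)) (trans (cong (Path.at P) same-index) (located v)))
                                          (<ᶠ⇒≢ u<v)
    where
    located : ∀ v → Path.at P (proj₁ (spans v)) ≡ v
    located v = proj₂ (proj₂ (spans v))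
    same-index : proj₁ (spans u) ≡ proj₁ (spans v)
    same-index = trans (sym (toℕ-fromℕ< _)) (trans (cong toℕ e) (toℕ-fromℕ< _))

  data Outcome : Set where
    saturated-path : (P : Path) → 2 ≤ Path.len P → RootNeighboursInner P → Outcome
    hamiltonian-cycle : (C : Cycle) → 2 ≤ Cycle.k C → Hamiltonian C → Outcome

  module _ (connected : Connected G) (3≤n : 3 ≤ n G) where

    private
      vertex : ∀ i → i < 3 → V
      vertex i i<3 = fromℕ< (<-≤-trans i<3 3≤n)

      another : ∀ v → ∃ λ u → u ≢ v
      another v with vertex 0 (s≤s z≤n) ≟ᶠ v
      ... | no v₀≢v = _ , v₀≢v
      ... | yes refl = vertex 1 (s≤s (s≤s z≤n)) , λ e →
        contradiction (trans (sym (toℕ-fromℕ< _)) (trans (cong toℕ e) (toℕ-fromℕ< _))) λ ()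

    has-neighbour : ∀ v → ∃ λ w → v ~ w
    has-neighbour v with another v
    ... | u , u≢v with crossing (_≡ v) (_≟ᶠ v) (connected v u) refl u≢v
    ...   | _ , w , refl , _ , v~w = w , v~w

    module _ (P : Path) where
      open Path P

      RootSaturated : Set
      RootSaturated = ∀ {w} → at 0 ~ w → OnPath P w

      open-end : RootSaturated → ¬ at 0 ~ at len → Outcome
      open-end saturated at0≁atlen = saturated-path P 2≤len inner
        where
        inner : RootNeighboursInner P
        inner at0~w with saturated at0~w
        ... | i , i≤len , refl with m≤n⇒m<n∨m≡n i≤len
        ...   | inj₁ i<len = i , i<len , refl
        ...   | inj₂ refl = contradiction at0~w at0≁atlen
        2≤len : 2 ≤ len
        2≤len with has-neighbour (at 0)
        ... | w , at0~w with inner at0~w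
        ...   | zero , _ , refl = contradiction at0~w ~-irrefl
        ...   | suc i , 1+i<len , _ = ≤-trans (s≤s (s≤s z≤n)) 1+i<len

      closed-end : at 0 ~ at len → (∃ λ Q → len < Path.len Q) ⊎ Outcome
      closed-end closing = extend-or-span (any? (λ u → ¬? (occurs? at len u)))
        where
        1≤len : 1 ≤ len
        1≤len = n≢0⇒n>0 λ len≡0 → ~-irrefl (subst (λ x → at 0 ~ at x) len≡0 closing)

        C = close P 1≤len closing

        extend-or-span : Dec (∃ λ u → ¬ OnPath P u) → (∃ λ Q → len < Path.len Q) ⊎ Outcome
        extend-or-span (yes (u , u∉P))
          with crossing (OnPath P) (occurs? at len) (connected (at 0) u) (0 , z≤n , refl) u∉P
        ... | _ , y , (i , i≤len , refl) , y∉P , ati~y = inj₁ (prepend Q y~Q₀ y∉Q , n<1+n len)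
          where
          Q = path-from C i
          y~Q₀ : y ~ Path.at Q 0
          y~Q₀ = subst (y ~_) (sym (trans (cong (Cycle.c C) (+-identityʳ i)) (close-at P 1≤len closing i≤len)))
                   (~-sym ati~y)
          y∉Q : ¬ OnPath Q y
          y∉Q (j , _ , e) = y∉P (subst (OnPath P) e (close-on-path P 1≤len closing (i + j)))
        extend-or-span (no spanning) = inj₂ (hamiltonian-cycle C 2≤len ham)
          where
          on-path : ∀ v → OnPath P v
          on-path v = decidable-stable (occurs? at len v) (λ v∉P → spanning (v , v∉P))
          ham : Hamiltonian C
          ham v with on-path v
          ... | i , i≤len , e = i , trans (close-at P 1≤len closing i≤len) e
          2≤len : 2 ≤ len
          2≤len = s≤s⁻¹ (≤-trans 3≤n (spanning-order-bound P on-path))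

      longer-or-outcome : (∃ λ Q → len < Path.len Q) ⊎ Outcome
      longer-or-outcome with any? (λ w → (at 0 ~? w) ×-dec ¬? (occurs? at len w))
      ... | yes (w , at0~w , w∉P) = inj₁ (prepend P (~-sym at0~w) w∉P , n<1+n len)
      ... | no no-exit with at 0 ~? at len
      ...   | yes closing = closed-end closing
      ...   | no at0≁atlen = inj₂ (open-end saturated at0≁atlen)
        where
        saturated : RootSaturated
        saturated {w} at0~w = decidable-stable (occurs? at len w) (λ w∉P → no-exit (w , at0~w , w∉P))

    outcome-from : (P : Path) → Acc _<_ (n G ∸ Path.len P) → Outcome
    outcome-from P (acc more) with longer-or-outcome P
    ... | inj₂ done = done
    ... | inj₁ (Q , longer) =
      outcome-from Q (more (∸-monoʳ-< longer (≤-trans (n≤1+n _) (path-order-bound Q))))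

    outcome : Outcome
    outcome = outcome-from single (<-wellFounded _)
      where
      single : Path
      single = record { len = 0 ; at = λ _ → vertex 0 (s≤s z≤n) ; at-adj = λ _ ()
                      ; at-distinct = λ i<j j≤0 → contradiction (<-≤-trans i<j j≤0) λ () }

  module HamiltonianColouring (C : Cycle) (ham : Hamiltonian C) where
    open Cycle C

    index : V → ℕ
    index v = proj₁ (hamiltonian-index C ham v)

    index≤k : ∀ v → index v ≤ k
    index≤k v = proj₁ (proj₂ (hamiltonian-index C ham v))

    c-index : ∀ v → c (index v) ≡ v
    c-index v = proj₂ (proj₂ (hamiltonian-index C ham v))

    index-c : ∀ {j} → j ≤ k → index (c j) ≡ j
    index-c j≤k = at-injective (unroll C) (index≤k _) j≤k (c-index _)

    located : ∀ {v j} → index v ≡ j → c j ≡ v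
    located {v} refl = c-index v

    data Position : ℕ → Set where
      first : Position 0
      inner : ∀ {i} → 2 + i ≤ k → Position (suc i)
      last : Position k

    position : ∀ {i} → i ≤ k → Position i
    position {zero} _ = first
    position {suc i} 1+i≤k with m≤n⇒m<n∨m≡n 1+i≤k
    ... | inj₁ 2+i≤k = inner 2+i≤k
    ... | inj₂ 1+i≡k = subst Position (sym 1+i≡k) last

    numeral≤k : ∀ {i m} → m ≤ k → T (i ≤ᵇ m) → i ≤ k
    numeral≤k {i} {m} m≤k i≤m = ≤-trans (≤ᵇ⇒≤ i m i≤m) m≤k

    module _ (h : ℕ → Fin 3) where
      f : V → Fin 3
      f = h ∘ index

      f-c : ∀ {j} → j ≤ k → f (c j) ≡ h j
      f-c j≤k = cong h (index-c j≤k)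

      dominated-by : ∀ {v} m {x y z} → x ≤ k → y ≤ k → z ≤ k →
                     c x ∈N[ v ] → c y ∈N[ v ] → c z ∈N[ v ] →
                     h x ≡ mod3 m → h y ≡ mod3 (1 + m) → h z ≡ mod3 (2 + m) → Dominated f v
      dominated-by m x≤ y≤ z≤ x∈ y∈ z∈ hx hy hz =
        consecutive⇒dominated m x∈ y∈ z∈ (trans (f-c x≤) hx) (trans (f-c y≤) hy) (trans (f-c z≤) hz)

      ascending : ∀ {i} m → 2 + i ≤ k →
                  h i ≡ mod3 m → h (1 + i) ≡ mod3 (1 + m) → h (2 + i) ≡ mod3 (2 + m) →
                  Dominated f (c (suc i))
      ascending m 2+i≤k = dominated-by m (≤-trans (n≤1+n _) (<⇒≤ 2+i≤k)) (<⇒≤ 2+i≤k) 2+i≤k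
                            (inj₂ (adjacent _)) (inj₁ refl) (inj₂ (~-sym (adjacent _)))

      descending : ∀ {i} m → 2 + i ≤ k →
                   h (2 + i) ≡ mod3 m → h (1 + i) ≡ mod3 (1 + m) → h i ≡ mod3 (2 + m) →
                   Dominated f (c (suc i))
      descending m 2+i≤k = dominated-by m 2+i≤k (<⇒≤ 2+i≤k) (≤-trans (n≤1+n _) (<⇒≤ 2+i≤k))
                             (inj₂ (~-sym (adjacent _))) (inj₁ refl) (inj₂ (adjacent _))

      cycle-colouring-admissible : 2 ≤ k → h 0 ≡ 0F → h 1 ≡ 1F → h 2 ≡ 2F → ∀ a b →
        (∀ {i} → i ≤ k → (i ≡ a ⊎ i ≡ b) ⊎ Dominated f (c i)) →
        (c a ~ c b → Dominated f (c a) ⊎ Dominated f (c b)) → ∃ Admissible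
      cycle-colouring-admissible 2≤k h0 h1 h2 a b classify pair =
        f , record
          { onto = onto-if-residues (trans (f-c z≤n) h0) (trans (f-c (<⇒≤ 2≤k)) h1) (trans (f-c 2≤k) h2)
          ; edge-dominated = edge-dominated }
        where
        exceptional : ∀ {u v} → u ~ v → index u ≡ a ⊎ index u ≡ b → index v ≡ a ⊎ index v ≡ b →
                      Dominated f u ⊎ Dominated f v
        exceptional u~v (inj₁ ua) (inj₁ va) = contradiction (trans (sym (located ua)) (located va)) (~⇒≢ u~v)
        exceptional u~v (inj₂ ub) (inj₂ vb) = contradiction (trans (sym (located ub)) (located vb)) (~⇒≢ u~v)
        exceptional u~v (inj₁ ua) (inj₂ vb) =
          Sum.map (subst (Dominated f) (located ua)) (subst (Dominated f) (located vb))
            (pair (subst₂ _~_ (sym (located ua)) (sym (located vb)) u~v))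
        exceptional u~v (inj₂ ub) (inj₁ va) = swap (exceptional (~-sym u~v) (inj₁ va) (inj₂ ub))

        edge-dominated : ∀ {u v} → u ~ v → Dominated f u ⊎ Dominated f v
        edge-dominated {u} {v} u~v with classify (index≤k u) | classify (index≤k v)
        ... | inj₂ u-dom | _ = inj₁ (subst (Dominated f) (c-index u) u-dom)
        ... | inj₁ _ | inj₂ v-dom = inj₂ (subst (Dominated f) (c-index v) v-dom)
        ... | inj₁ u-exc | inj₁ v-exc = exceptional u~v u-exc v-exc

      last-after-predecessor : 1 ≤ k → h 0 ≡ 0F → h k ≡ 1F → h (k ∸ 1) ≡ 2F → Dominated f (c k)
      last-after-predecessor 1≤k h0 hk hk′ =
        dominated-by 0 z≤n ≤-refl (m∸n≤m k 1) (inj₂ (~-sym (wrap C))) (inj₁ refl) (inj₂ k′~k)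
          h0 hk hk′
        where
        k′~k : c (k ∸ 1) ~ c k
        k′~k = subst (λ x → c (k ∸ 1) ~ c x) (m+[n∸m]≡n 1≤k) (adjacent (k ∸ 1))

    -- Recolouring c k makes it see c (k ∸ 1), c k, c 0 coloured 2, 1, 0; only c 0 and c (k ∸ 1) can
    -- then lie in 𝒳.
    module _ (3≤k : 3 ≤ k) (k≡0 : mod3 k ≡ 0F) where
      private
        1≤k : 1 ≤ k
        1≤k = numeral≤k 3≤k _
        1<k : 1 < k
        1<k = numeral≤k 3≤k _

        h : ℕ → Fin 3
        h i with i ≟ k
        ... | yes _ = 1F
        ... | no _ = mod3 i

        h-below : ∀ {i} → i < k → h i ≡ mod3 i
        h-below {i} i<k with i ≟ k
        ... | yes i≡k = contradiction i≡k (<⇒≢ i<k)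
        ... | no _ = refl

        h-k : h k ≡ 1F
        h-k with k ≟ k
        ... | yes _ = refl
        ... | no k≢k = contradiction refl k≢k

        k′<k : k ∸ 1 < k
        k′<k = subst (k ∸ 1 <_) (m+[n∸m]≡n 1≤k) ≤-refl

        h-k′ : h (k ∸ 1) ≡ 2F
        h-k′ = trans (h-below k′<k) (mod3≡0⇒∸1 1≤k k≡0)

        classify : ∀ {i} → i ≤ k → (i ≡ 0 ⊎ i ≡ k ∸ 1) ⊎ Dominated (f h) (c i)
        classify i≤k with position i≤k
        ... | first = inj₁ (inj₁ refl)
        ... | last = inj₂ (last-after-predecessor h 1≤k (h-below 1≤k) h-k h-k′)
        ... | inner {i} 2+i≤k with suc i ≟ k ∸ 1
        ...   | yes 1+i≡k′ = inj₁ (inj₂ 1+i≡k′)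
        ...   | no 1+i≢k′ =
          inj₂ (ascending h i 2+i≤k (h-below (<-trans (n<1+n i) 1+i<k)) (h-below 1+i<k) (h-below 2+i<k))
          where
          1+i<k : suc i < k
          1+i<k = 2+i≤k
          1+i≤k′ : suc i ≤ k ∸ 1
          1+i≤k′ = s≤s⁻¹ (subst (2 + i ≤_) (sym (m+[n∸m]≡n 1≤k)) 2+i≤k)
          2+i<k : 2 + i < k
          2+i<k = ≤-<-trans (≤∧≢⇒< 1+i≤k′ 1+i≢k′) k′<k

        pair : c 0 ~ c (k ∸ 1) → Dominated (f h) (c 0) ⊎ Dominated (f h) (c (k ∸ 1))
        pair c0~ck′ = inj₁ (dominated-by h 0 z≤n (<⇒≤ 1<k) (<⇒≤ k′<k)
                              (inj₁ refl) (inj₂ (~-sym (adjacent 0))) (inj₂ (~-sym c0~ck′))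
                              (h-below 1≤k) (h-below 1<k) h-k′)

      admissible-if-k≡0 : ∃ Admissible
      admissible-if-k≡0 = cycle-colouring-admissible h (<⇒≤ 3≤k) (h-below 1≤k) (h-below 1<k) (h-below 3≤k)
                             0 (k ∸ 1) classify pair

    -- c 4, …, c k are coloured by their distance to c (suc k) = c 0 going backwards, which agrees with
    -- the position of c 4 mod 3 since suc k ≡ 2. Only c 0 and c 4 can then lie in 𝒳.
    module _ (7≤k : 7 ≤ k) (k≡1 : mod3 k ≡ 1F) (c0≁c4 : ¬ c 0 ~ c 4) where
      private
        ≤k : ∀ {i} → T (i ≤ᵇ 7) → i ≤ k
        ≤k = numeral≤k 7≤k

        h : ℕ → Fin 3
        h i with i ≤? 3
        ... | yes _ = mod3 i
        ... | no _ = mod3 (suc k ∸ i)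

        h-low : ∀ {i} → T (i ≤ᵇ 3) → h i ≡ mod3 i
        h-low {i} i≤3 with i ≤? 3
        ... | yes _ = refl
        ... | no i≰3 = contradiction (≤ᵇ⇒≤ i 3 i≤3) i≰3

        h-high : ∀ {i} → 4 ≤ i → h i ≡ mod3 (suc k ∸ i)
        h-high {i} 4≤i with i ≤? 3
        ... | yes i≤3 = contradiction i≤3 (<⇒≱ 4≤i)
        ... | no _ = refl

        h-4 : h 4 ≡ 1F
        h-4 = trans (h-high ≤-refl) (trans (mod3-∸3 (≤k _)) k≡1)

        h-high-suc : ∀ {i} → 4 ≤ i → i ≤ k → h i ≡ mod3 (suc (k ∸ i))
        h-high-suc 4≤i i≤k = trans (h-high 4≤i) (cong mod3 (+-∸-assoc 1 i≤k))

        h-k′ : h (k ∸ 1) ≡ 2F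
        h-k′ = trans (h-high (m+n≤o⇒m≤o∸n 4 (≤k {5} _))) (cong mod3 (two k (≤k _)))
          where
          two : ∀ m → 1 ≤ m → suc m ∸ (m ∸ 1) ≡ 2
          two (suc m) _ = m+n∸n≡m 2 m

        classify : ∀ {i} → i ≤ k → (i ≡ 0 ⊎ i ≡ 4) ⊎ Dominated (f h) (c i)
        classify i≤k with position i≤k
        ... | first = inj₁ (inj₁ refl)
        ... | inner {0} 2≤k = inj₂ (ascending h 0 2≤k (h-low {0} _) (h-low {1} _) (h-low {2} _))
        ... | inner {1} 3≤k = inj₂ (ascending h 1 3≤k (h-low {1} _) (h-low {2} _) (h-low {3} _))
        ... | inner {2} 4≤k = inj₂ (ascending h 2 4≤k (h-low {2} _) (h-low {3} _) h-4)
        ... | inner {3} _ = inj₁ (inj₂ refl)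
        ... | inner {i@(suc (suc (suc (suc _))))} 2+i≤k =
          inj₂ (descending h (k ∸ suc i) 2+i≤k (h-high (≤-trans 4≤i (≤-trans (n≤1+n _) (n≤1+n _))))
                 (h-high-suc (≤-trans 4≤i (n≤1+n i)) 1+i≤k)
                 (trans (h-high-suc 4≤i (≤-trans (n≤1+n i) 1+i≤k))
                        (cong (mod3 ∘ suc) (+-∸-assoc 1 1+i≤k))))
          where
          4≤i : 4 ≤ i
          4≤i = ≤ᵇ⇒≤ 4 i _
          1+i≤k : suc i ≤ k
          1+i≤k = <⇒≤ 2+i≤k
        ... | last = inj₂ (last-after-predecessor h (≤k _) refl
                             (trans (h-high (≤k _)) (cong mod3 (m+n∸n≡m 1 k))) h-k′)

      admissible-if-4-chord-missing : ∃ Admissible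
      admissible-if-4-chord-missing =
        cycle-colouring-admissible h (≤k _) refl refl refl 0 4 classify
          (λ c0~c4 → contradiction c0~c4 c0≁c4)

    -- The chords c 2 c 6, c 4 c 0 and c k c 3 supply the colour missing at c 2, c 4 and c k; only c 0
    -- and c 3 can then lie in 𝒳.
    module _ (7≤k : 7 ≤ k) (k≡1 : mod3 k ≡ 1F) (c0~c4 : c 0 ~ c 4) (c2~c6 : c 2 ~ c 6) (ck~c3 : c k ~ c 3)
             (c0≁c3 : ¬ c 0 ~ c 3) where
      private
        ≤k : ∀ {i} → T (i ≤ᵇ 7) → i ≤ k
        ≤k = numeral≤k 7≤k

        h : ℕ → Fin 3
        h i with i ≟ 3
        ... | yes _ = 2F
        ... | no _ = mod3 i

        h-other : ∀ {i} → i ≢ 3 → h i ≡ mod3 i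
        h-other {i} i≢3 with i ≟ 3
        ... | yes i≡3 = contradiction i≡3 i≢3
        ... | no _ = refl

        classify : ∀ {i} → i ≤ k → (i ≡ 0 ⊎ i ≡ 3) ⊎ Dominated (f h) (c i)
        classify i≤k with position i≤k
        ... | first = inj₁ (inj₁ refl)
        ... | inner {0} 2≤k = inj₂ (ascending h 0 2≤k refl refl refl)
        ... | inner {1} _ = inj₂ (dominated-by h 0 (≤k _) (≤k _) (≤k _)
                                   (inj₂ (~-sym c2~c6)) (inj₂ (adjacent 1)) (inj₁ refl) refl refl refl)
        ... | inner {2} _ = inj₁ (inj₂ refl)
        ... | inner {3} _ = inj₂ (dominated-by h 0 z≤n (≤k _) (≤k _)
                                   (inj₂ c0~c4) (inj₁ refl) (inj₂ (adjacent 3)) refl refl refl)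
        ... | inner {i@(suc (suc (suc (suc _))))} 2+i≤k =
          inj₂ (ascending h i 2+i≤k (h-other {i} λ ()) (h-other {1 + i} λ ()) (h-other {2 + i} λ ()))
        ... | last = inj₂ (dominated-by h 0 z≤n ≤-refl (≤k _)
                             (inj₂ (~-sym (wrap C))) (inj₁ refl) (inj₂ (~-sym ck~c3))
                             refl (trans (h-other (>⇒≢ (≤k _))) k≡1) refl)

      admissible-if-4-chords : ∃ Admissible
      admissible-if-4-chords =
        cycle-colouring-admissible h (≤k _) refl refl refl 0 3 classify (λ c0~c3 → contradiction c0~c3 c0≁c3)

    module _ (k≡4 : k ≡ 4) (no-2-chord : ∀ {s} → s ≤ 4 → ¬ c s ~ c (s + 2)) where
      private
        c5 : Fin 5 → V
        c5 a = c (toℕ a)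

        periodic5 : ∀ i → c (i + 5) ≡ c i
        periodic5 i = subst (λ x → c (i + suc x) ≡ c i) k≡4 (periodic i)

        c4~c0 : c 4 ~ c 0
        c4~c0 = subst (λ x → c x ~ c 0) k≡4 (wrap C)

        c3≁c0 : ¬ c 3 ~ c 0
        c3≁c0 = subst (λ x → ¬ c 3 ~ x) (periodic5 0) (no-2-chord (≤ᵇ⇒≤ 3 4 _))

        c4≁c1 : ¬ c 4 ~ c 1
        c4≁c1 = subst (λ x → ¬ c 4 ~ x) (periodic5 1) (no-2-chord ≤-refl)

        Same : Set → Set → Set
        Same A B = (A → B) × (B → A)

        edge : ∀ {x y} → x ~ y → Same (x ~ y) ⊤
        edge x~y = _ , λ _ → x~y

        gap : ∀ {x y} → ¬ x ~ y → Same (x ~ y) ⊥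
        gap x≁y = x≁y , λ ()

        adjacency : ∀ a b → Same (c5 a ~ c5 b) (T (c5adj a b))
        adjacency 0F 0F = gap ~-irrefl
        adjacency 0F 1F = edge (adjacent 0)
        adjacency 0F 2F = gap (no-2-chord (≤ᵇ⇒≤ 0 4 _))
        adjacency 0F 3F = gap (c3≁c0 ∘ ~-sym)
        adjacency 0F 4F = edge (~-sym c4~c0)
        adjacency 1F 0F = edge (~-sym (adjacent 0))
        adjacency 1F 1F = gap ~-irrefl
        adjacency 1F 2F = edge (adjacent 1)
        adjacency 1F 3F = gap (no-2-chord (≤ᵇ⇒≤ 1 4 _))
        adjacency 1F 4F = gap (c4≁c1 ∘ ~-sym)
        adjacency 2F 0F = gap (no-2-chord (≤ᵇ⇒≤ 0 4 _) ∘ ~-sym)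
        adjacency 2F 1F = edge (~-sym (adjacent 1))
        adjacency 2F 2F = gap ~-irrefl
        adjacency 2F 3F = edge (adjacent 2)
        adjacency 2F 4F = gap (no-2-chord (≤ᵇ⇒≤ 2 4 _))
        adjacency 3F 0F = gap c3≁c0
        adjacency 3F 1F = gap (no-2-chord (≤ᵇ⇒≤ 1 4 _) ∘ ~-sym)
        adjacency 3F 2F = edge (~-sym (adjacent 2))
        adjacency 3F 3F = gap ~-irrefl
        adjacency 3F 4F = edge (adjacent 3)
        adjacency 4F 0F = edge c4~c0
        adjacency 4F 1F = gap c4≁c1
        adjacency 4F 2F = gap (no-2-chord (≤ᵇ⇒≤ 2 4 _) ∘ ~-sym)
        adjacency 4F 3F = edge (~-sym (adjacent 3))
        adjacency 4F 4F = gap ~-irrefl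

        φ : V → Fin 5
        φ v = fromℕ< (s≤s (subst (index v ≤_) k≡4 (index≤k v)))

        c5-φ : ∀ v → c5 (φ v) ≡ v
        c5-φ v = trans (cong c (toℕ-fromℕ< _)) (c-index v)

      C5-isomorphism : Isomorphic G C5
      C5-isomorphism = mk⤖ (injective , surjective) , preserves
        where
        injective : ∀ {u v} → φ u ≡ φ v → u ≡ v
        injective {u} {v} e = trans (sym (c5-φ u)) (trans (cong c5 e) (c5-φ v))

        surjective : ∀ a → ∃ λ v → ∀ {u} → u ≡ v → φ u ≡ a
        surjective a = c5 a , λ { refl → toℕ-injective (trans (toℕ-fromℕ< _) (index-c a≤k)) }
          where
          a≤k : toℕ a ≤ k
          a≤k = subst (toℕ a ≤_) (sym k≡4) (s≤s⁻¹ (toℕ<n a))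

        preserves : ∀ u v → (u ~ v → T (c5adj (φ u) (φ v))) × (T (c5adj (φ u) (φ v)) → u ~ v)
        preserves u v =
          (λ u~v → proj₁ (adjacency (φ u) (φ v)) (subst₂ _~_ (sym (c5-φ u)) (sym (c5-φ v)) u~v)) ,
          (λ uv∈C5 → subst₂ _~_ (c5-φ u) (c5-φ v) (proj₂ (adjacency (φ u) (φ v)) uv∈C5))

  open HamiltonianColouring
    using (admissible-if-k≡0; admissible-if-4-chord-missing; admissible-if-4-chords; C5-isomorphism)

  module _ (connected : Connected G) (C : Cycle) (ham : Hamiltonian C) (2≤k : 2 ≤ Cycle.k C) where
    open Cycle C

    Residue2Chord : Set
    Residue2Chord = ∃ λ s → s < suc k × ∃ λ j → j < suc k × mod3 j ≡ 2F × c s ~ c (s + j)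

    residue-2-chord? : Dec Residue2Chord
    residue-2-chord? =
      anyUpTo? (λ s → anyUpTo? (λ j → (mod3 j ≟ᶠ 2F) ×-dec (c s ~? c (s + j))) (suc k)) (suc k)

    residue-2-chord-admissible : Residue2Chord → ∃ Admissible
    residue-2-chord-admissible (s , _ , j , j<1+k , j≡2 , chord) =
      path-admissible (path-from C s) connected 2≤k
        (inj₁ (j , s≤s⁻¹ j<1+k , j≡2 , subst (λ x → c x ~ c (s + j)) (sym (+-identityʳ s)) chord))

    chordless-admissible : ¬ Isomorphic G C5 → mod3 k ≡ 1F → ¬ Residue2Chord → ∃ Admissible
    chordless-admissible ≇C5 k≡1 no-chord with k ≟ 4
    ... | yes k≡4 = contradiction (C5-isomorphism C ham k≡4 no-2-chord) ≇C5
      where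
      no-2-chord : ∀ {s} → s ≤ 4 → ¬ c s ~ c (s + 2)
      no-2-chord s≤4 chord =
        no-chord (_ , s≤s (subst (_ ≤_) (sym k≡4) s≤4) , 2 , s≤s 2≤k , refl , chord)
    ... | no k≢4 = four-chords (anyUpTo? (λ s → ¬? (c s ~? c (s + 4))) (suc k))
      where
      7≤k : 7 ≤ k
      7≤k = mod3≡1⇒7≤ 2≤k k≢4 k≡1

      c0≁c3 : ¬ c 0 ~ c 3
      c0≁c3 c0~c3 = no-chord (3 , s≤s (≤-trans (≤ᵇ⇒≤ 3 7 _) 7≤k) , k ∸ 2 , s≤s (m∸n≤m k 2) ,
                              mod3≡1⇒∸2 2≤k k≡1 , subst (c 3 ~_) (sym wrap-to-0) (~-sym c0~c3))
        where
        wrap-to-0 : c (3 + (k ∸ 2)) ≡ c 0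
        wrap-to-0 = trans (cong (c ∘ suc) (m+[n∸m]≡n 2≤k)) (periodic 0)

      four-chords : Dec (∃ λ s → s < suc k × ¬ c s ~ c (s + 4)) → ∃ Admissible
      four-chords (yes (s , _ , cs≁cs+4)) =
        admissible-if-4-chord-missing (rotate C s) (rotate-hamiltonian C s ham) 7≤k k≡1
          (subst (λ x → ¬ c x ~ c (s + 4)) (sym (+-identityʳ s)) cs≁cs+4)
      four-chords (no none) =
        admissible-if-4-chords C ham 7≤k k≡1 (chord z≤n) (chord 2≤k)
          (subst (c k ~_) (trans (cong c (+-comm k 4)) (periodic 3)) (chord ≤-refl)) c0≁c3
        where
        chord : ∀ {s} → s ≤ k → c s ~ c (s + 4)
        chord {s} s≤k = decidable-stable (c s ~? c (s + 4)) (λ cs≁cs+4 → none (s , s≤s s≤k , cs≁cs+4))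

    hamiltonian-admissible : ¬ Isomorphic G C5 → ∃ Admissible
    hamiltonian-admissible ≇C5 with mod3 k in k-residue
    ... | 2F = path-admissible (path-from C 0) connected 2≤k (inj₁ (k , ≤-refl , k-residue , ~-sym (wrap C)))
    ... | 0F = admissible-if-k≡0 C ham (mod3≡0⇒3≤ 2≤k k-residue) k-residue
    ... | 1F with residue-2-chord?
    ...   | yes chord = residue-2-chord-admissible chord
    ...   | no no-chord = chordless-admissible ≇C5 k-residue no-chord

admissible-colouring : (G : Graph) → Connected G → 3 ≤ n G → ¬ Isomorphic G C5 → ∃ (Admissible G)
admissible-colouring G connected 3≤n ≇C5 with outcome G connected 3≤n
... | saturated-path P 2≤len inner = path-admissible G P connected 2≤len (inj₂ inner)
... | hamiltonian-cycle C 2≤k ham = hamiltonian-admissible G connected C ham 2≤k ≇C5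

theorem2 : (G : Graph) → Connected G → 3 ≤ n G → ¬ Isomorphic G C5 →
    ∃ λ (f : Fin (n G) → Fin 3) → IsPartition3 G f × Independent G (InX G f)
theorem2 G connected 3≤n ≇C5 with admissible-colouring G connected 3≤n ≇C5
... | f , admissible = f , Admissible.onto admissible , admissible⇒independent G admissible
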